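{- Let $G$ be a graph on $n$ vertices and let $p\geq 2$ be an integer. Then the limit $\lim_{k\to\infty}\alpha(G^{k_{(p)}})^{1/k}$ exists, and, denoting it by $x_\alpha^{(p)}(G)$, it satisfies $$ n^{1/p}\leq x_\alpha^{(p)}(G)=\sup_{k\geq 1}\alpha(G^{k_{(p)}})^{1/k}\leq n.$$
   Context: For integers $k,p\geq 1$, the $k$-th $p$-power of a graph $G$, denoted $G^{k_{(p)}}$, is the graph with vertex set $V(G)^k$ in which two $k$-tuples $(u_1,\dots,u_k)$ and $(v_1,\dots,v_k)$ are adjacent iff $|\{i: u_iv_i\in E(G)\}|\not\equiv 0 \pmod p$. $\alpha(\cdot)$ denotes the independence number. -}

module Defs where

open import Data.Nat using (ℕ; zero; suc; _+_; _≤_)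
open import Data.Nat.Divisibility using (_∣_)
open import Data.Fin using (Fin)
open import Data.Bool using (Bool; true; false)
open import Data.Vec using (Vec; []; _∷_)
open import Data.List using (List; length)
open import Data.List.Membership.Propositional using (_∈_)
open import Data.List.Relation.Unary.Unique.Propositional using (Unique)
open import Data.Product using (Σ; _×_)
open import Relation.Nullary using (¬_)
open import Relation.Binary.PropositionalEquality using (_≡_)

record Graph (n : ℕ) : Set where
  field
    adj        : Fin n → Fin n → Bool
    adj-sym    : ∀ u v → adj u v ≡ adj v u
    adj-irrefl : ∀ v → adj v v ≡ false
open Graph public

edgeCount : ∀ {n k} → Graph n → Vec (Fin n) k → Vec (Fin n) k → ℕ
edgeCount G [] [] = 0
edgeCount G (u ∷ us) (v ∷ vs) with adj G u v
... | true  = suc (edgeCount G us vs)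
... | false = edgeCount G us vs

PowAdj : ∀ {n} → Graph n → (p k : ℕ) → Vec (Fin n) k → Vec (Fin n) k → Set
PowAdj G p k x y = ¬ (p ∣ edgeCount G x y)

IsIndependent : {V : Set} → (V → V → Set) → List V → Set
IsIndependent {V} Adj S = Unique S × (∀ {x y : V} → x ∈ S → y ∈ S → ¬ Adj x y)

IsIndependenceNumber : {V : Set} → (V → V → Set) → ℕ → Set
IsIndependenceNumber {V} Adj a =
  (Σ (List V) λ S → IsIndependent Adj S × length S ≡ a)
  × (∀ (S : List V) → IsIndependent Adj S → length S ≤ a)

{-# OPTIONS --safe #-}
module Submission where

-- Concatenating tuples turns independent sets of G^{a_(p)} and G^{b_(p)} into one of
-- G^{(a+b)_(p)}, because edge counts add; so α is supermultiplicative and Fekete's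
-- argument makes lim α_k^{1/k} equal to sup α_k^{1/k}. The n constant p-tuples are
-- pairwise non-adjacent in G^{p_(p)}, their edge count being 0 or p, so α_p ≥ n;
-- and α_k ≤ |V(G)^k| = n^k.

open import Defs
open import Data.Nat using (ℕ; zero; suc; _+_; _*_; _^_; _≤_; _<_; z≤n; s≤s; >-nonZero)
open import Data.Nat.Properties
open import Data.Nat.Divisibility using (_∣_; _∣?_; ∣-refl; _∣0; ∣m∣n⇒∣m+n)
open import Data.Nat.DivMod using (_/_; _%_; m≡m%n+[m/n]*n; m%n<n)
open import Data.Nat.Tactic.RingSolver using (solve-∀)
open import Data.Fin using (Fin; fromℕ<)
open import Data.Bool using (true; false)
open import Data.Vec using (Vec; []; _∷_; _++_; replicate; lookup)
open import Data.Vec.Properties using (++-injective; ∷-injectiveˡ)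
open import Data.List as List using (List; length; cartesianProductWith; allFin; map; [_])
open import Data.List.Properties using (length-++; length-map; length-tabulate; length-removeAt′)
open import Data.List.Membership.Propositional using (_∈_; _─_)
open import Data.List.Membership.Propositional.Properties
  using (∈-cartesianProductWith⁺; ∈-cartesianProductWith⁻; ∈-allFin; ∈-map⁻)
open import Data.List.Relation.Binary.Subset.Propositional using (_⊆_)
open import Data.List.Relation.Unary.Any using (here; there)
open import Data.List.Relation.Unary.All as All using ()
open import Data.List.Relation.Unary.AllPairs using (_∷_; [])
open import Data.List.Relation.Unary.Unique.Propositional using (Unique)
import Data.List.Relation.Unary.Unique.Propositional.Properties as Unique
open import Data.Product using (_×_; _,_; ∃; ∃₂)
open import Relation.Nullary using (¬_; contradiction)
open import Relation.Nullary.Decidable using (decidable-stable)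
open import Relation.Binary.PropositionalEquality hiding ([_])

^-distribʳ-* : ∀ m n q → (m * n) ^ q ≡ m ^ q * n ^ q
^-distribʳ-* m n zero    = refl
^-distribʳ-* m n (suc q) = begin
  m * n * (m * n) ^ q     ≡⟨ cong (m * n *_) (^-distribʳ-* m n q) ⟩
  m * n * (m ^ q * n ^ q) ≡⟨ interchange m n (m ^ q) (n ^ q) ⟩
  m * m ^ q * (n * n ^ q) ∎
  where
  open ≡-Reasoning
  interchange : ∀ a b c d → a * b * (c * d) ≡ a * c * (b * d)
  interchange = solve-∀

x^q*[x+q]≤x*[1+x]^q : ∀ x q → x ^ q * (x + q) ≤ x * suc x ^ q
x^q*[x+q]≤x*[1+x]^q x zero = ≤-reflexive (unit x)
  where
  unit : ∀ a → 1 * (a + 0) ≡ a * 1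
  unit = solve-∀
x^q*[x+q]≤x*[1+x]^q x (suc q) = begin
  x * x ^ q * (x + suc q)             ≡⟨ expand x (x ^ q) q ⟩
  x * (x ^ q * (x + q)) + x * x ^ q   ≤⟨ +-mono-≤ (*-monoʳ-≤ x (x^q*[x+q]≤x*[1+x]^q x q))
                                                   (*-monoʳ-≤ x (^-monoˡ-≤ q (n≤1+n x))) ⟩
  x * (x * suc x ^ q) + x * suc x ^ q ≡⟨ collect x (suc x ^ q) ⟩
  x * (suc x * suc x ^ q)             ∎
  where
  open ≤-Reasoning
  expand : ∀ a b c → a * b * (a + suc c) ≡ a * (b * (a + c)) + a * b
  expand = solve-∀
  collect : ∀ a b → a * (a * b) + a * b ≡ a * (suc a * b)
  collect = solve-∀

x^q*c<[1+x]^q : ∀ x c q → c * x < q → x ^ q * c < suc x ^ q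
x^q*c<[1+x]^q zero    c zero    cx<q = contradiction cx<q n≮0
x^q*c<[1+x]^q zero    c (suc q) _    rewrite ^-zeroˡ q = s≤s z≤n
x^q*c<[1+x]^q x@(suc _) c q cx<q = *-cancelˡ-< x (x ^ q * c) (suc x ^ q) (begin-strict
  x * (x ^ q * c)  ≡⟨ rotate x (x ^ q) c ⟩
  x ^ q * (c * x)  <⟨ *-monoʳ-< (x ^ q) {{m^n≢0 x q}} (<-≤-trans cx<q (m≤n+m q x)) ⟩
  x ^ q * (x + q)  ≤⟨ x^q*[x+q]≤x*[1+x]^q x q ⟩
  x * suc x ^ q    ∎)
  where
  open ≤-Reasoning
  rotate : ∀ a b c → a * (b * c) ≡ b * (c * a)
  rotate = solve-∀

m<n*o⇒0<o : ∀ {m} n o → m < n * o → 0 < o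
m<n*o⇒0<o {m} n zero    m<n*0 = contradiction (subst (m <_) (*-zeroʳ n) m<n*0) n≮0
m<n*o⇒0<o     n (suc o) _     = s≤s z≤n

m*j<k⇒k≡q*j+r : ∀ m j k → 1 ≤ j → m * j < k →
  ∃₂ λ q r → m < suc q × 1 ≤ r × r ≤ j × k ≡ q * j + r
m*j<k⇒k≡q*j+r m j@(suc _) (suc k) _ mj<k = q , suc r , m<1+q , s≤s z≤n , m%n<n k j , k≡q*j+r
  where
  q = k / j
  r = k % j
  k≡q*j+r : suc k ≡ q * j + suc r
  k≡q*j+r = begin
    suc k             ≡⟨ cong suc (m≡m%n+[m/n]*n k j) ⟩
    suc (r + q * j)   ≡⟨ cong suc (+-comm r (q * j)) ⟩
    suc (q * j + r)   ≡⟨ sym (+-suc (q * j) r) ⟩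
    q * j + suc r     ∎
    where open ≡-Reasoning
  m<1+q : m < suc q
  m<1+q = *-cancelʳ-< j m (suc q) (begin-strict
    m * j             <⟨ mj<k ⟩
    suc k             ≡⟨ k≡q*j+r ⟩
    q * j + suc r     ≤⟨ +-monoʳ-≤ (q * j) (m%n<n k j) ⟩
    q * j + j         ≡⟨ +-comm (q * j) j ⟩
    suc q * j         ∎)
    where open ≤-Reasoning

SuperMultiplicative : (ℕ → ℕ) → Set
SuperMultiplicative α = ∀ a b → 1 ≤ a → 1 ≤ b → α a * α b ≤ α (a + b)

module _ {α : ℕ → ℕ} (α-super : SuperMultiplicative α) where

  α^q*α≤α : ∀ j q r → 1 ≤ j → 1 ≤ r → α j ^ q * α r ≤ α (q * j + r)
  α^q*α≤α j zero    r _   _   = ≤-reflexive (+-identityʳ (α r))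
  α^q*α≤α j (suc q) r j≥1 r≥1 = begin
    α j * α j ^ q * α r     ≡⟨ *-assoc (α j) (α j ^ q) (α r) ⟩
    α j * (α j ^ q * α r)   ≤⟨ *-monoʳ-≤ (α j) (α^q*α≤α j q r j≥1 r≥1) ⟩
    α j * α (q * j + r)     ≤⟨ α-super j (q * j + r) j≥1 (≤-trans r≥1 (m≤n+m r (q * j))) ⟩
    α (j + (q * j + r))     ≡⟨ cong α (sym (+-assoc j (q * j) r)) ⟩
    α (suc q * j + r)       ∎
    where open ≤-Reasoning

  -- Write k = q j + r with 1 ≤ r ≤ j. Then α k ≥ α j ^ q · α r, and u^k ≤ x^q c with
  -- x = u^j, c = (1+u)^j; once q > c x the factor c is absorbed, x^q c < (1+x)^q.
  eventually-above : (∀ k → 1 ≤ k → 0 < α k) →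
    ∀ j u v → 1 ≤ j → 1 ≤ v → u ^ j < v ^ j * α j →
    ∃ λ K → ∀ k → K ≤ k → u ^ k < v ^ k * α k
  eventually-above α-pos j u v j≥1 v≥1 uʲ<vʲαⱼ = suc (suc (c * x) * j) , above
    where
    x = u ^ j
    c = suc u ^ j
    split : ∀ m q r → m ^ (q * j + r) ≡ (m ^ j) ^ q * m ^ r
    split m q r = begin
      m ^ (q * j + r)     ≡⟨ ^-distribˡ-+-* m (q * j) r ⟩
      m ^ (q * j) * m ^ r ≡⟨ cong (λ e → m ^ e * m ^ r) (*-comm q j) ⟩
      m ^ (j * q) * m ^ r ≡⟨ cong (_* m ^ r) (sym (^-*-assoc m j q)) ⟩
      (m ^ j) ^ q * m ^ r ∎
      where open ≡-Reasoning
    above : ∀ k → suc (suc (c * x) * j) ≤ k → u ^ k < v ^ k * α k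
    above k K≤k with q , r , cx<q , r≥1 , r≤j , refl ← m*j<k⇒k≡q*j+r (suc (c * x)) j k j≥1 K≤k =
      begin-strict
      u ^ (q * j + r)                       ≡⟨ split u q r ⟩
      x ^ q * u ^ r                         ≤⟨ *-monoʳ-≤ (x ^ q) uʳ≤c ⟩
      x ^ q * c                             <⟨ x^q*c<[1+x]^q x c q (≤-pred cx<q) ⟩
      suc x ^ q                             ≤⟨ ^-monoˡ-≤ q uʲ<vʲαⱼ ⟩
      (v ^ j * α j) ^ q                     ≡⟨ ^-distribʳ-* (v ^ j) (α j) q ⟩
      (v ^ j) ^ q * α j ^ q                 ≤⟨ *-mono-≤ (m≤m*n ((v ^ j) ^ q) (v ^ r) {{vʳ≢0}})
                                                        (m≤m*n (α j ^ q) (α r) {{αᵣ≢0}}) ⟩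
      (v ^ j) ^ q * v ^ r * (α j ^ q * α r) ≤⟨ *-monoʳ-≤ ((v ^ j) ^ q * v ^ r) (α^q*α≤α j q r j≥1 r≥1) ⟩
      (v ^ j) ^ q * v ^ r * α (q * j + r)   ≡⟨ cong (_* α (q * j + r)) (sym (split v q r)) ⟩
      v ^ (q * j + r) * α (q * j + r)       ∎
      where
      open ≤-Reasoning
      uʳ≤c : u ^ r ≤ c
      uʳ≤c = ≤-trans (^-monoˡ-≤ r (n≤1+n u)) (^-monoʳ-≤ (suc u) r≤j)
      vʳ≢0 = m^n≢0 v r {{>-nonZero v≥1}}
      αᵣ≢0 = >-nonZero (α-pos r r≥1)

module _ {A : Set} where

  ∈-─⁺ : ∀ {x z : A} {ys} (x∈ys : x ∈ ys) → z ∈ ys → z ≢ x → z ∈ ys ─ x∈ys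
  ∈-─⁺ (here refl)  (here refl)  z≢x = contradiction refl z≢x
  ∈-─⁺ (here refl)  (there z∈ys) _   = z∈ys
  ∈-─⁺ (there _)    (here refl)  _   = here refl
  ∈-─⁺ (there x∈ys) (there z∈ys) z≢x = there (∈-─⁺ x∈ys z∈ys z≢x)

  Unique-length-≤ : ∀ {xs ys : List A} → Unique xs → xs ⊆ ys → length xs ≤ length ys
  Unique-length-≤ {List.[]}     _               _     = z≤n
  Unique-length-≤ {x List.∷ xs} {ys} (x∉xs ∷ xs!) xs⊆ys = begin
    suc (length xs)            ≤⟨ s≤s (Unique-length-≤ xs! xs⊆ys─x) ⟩
    suc (length (ys ─ x∈ys))   ≡⟨ sym (length-removeAt′ ys _) ⟩
    length ys                  ∎
    where
    open ≤-Reasoning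
    x∈ys = xs⊆ys (here refl)
    xs⊆ys─x : xs ⊆ ys ─ x∈ys
    xs⊆ys─x z∈xs = ∈-─⁺ x∈ys (xs⊆ys (there z∈xs)) (λ z≡x → All.lookup x∉xs z∈xs (sym z≡x))

length-cartesianProductWith : ∀ {A B C : Set} (f : A → B → C) xs ys →
  length (cartesianProductWith f xs ys) ≡ length xs * length ys
length-cartesianProductWith f List.[]       ys = refl
length-cartesianProductWith f (x List.∷ xs) ys = begin
  length (map (f x) ys List.++ cartesianProductWith f xs ys) ≡⟨ length-++ (map (f x) ys) ⟩
  length (map (f x) ys) + length (cartesianProductWith f xs ys)
    ≡⟨ cong₂ _+_ (length-map (f x) ys) (length-cartesianProductWith f xs ys) ⟩
  length ys + length xs * length ys
    ∎
  where open ≡-Reasoning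

allVecs : ∀ n k → List (Vec (Fin n) k)
allVecs n zero    = [ [] ]
allVecs n (suc k) = cartesianProductWith _∷_ (allFin n) (allVecs n k)

∈-allVecs : ∀ {n k} (v : Vec (Fin n) k) → v ∈ allVecs n k
∈-allVecs []      = here refl
∈-allVecs (a ∷ v) = ∈-cartesianProductWith⁺ _∷_ (∈-allFin a) (∈-allVecs v)

length-allVecs : ∀ n k → length (allVecs n k) ≡ n ^ k
length-allVecs n zero    = refl
length-allVecs n (suc k) = begin
  length (allVecs n (suc k))
    ≡⟨ length-cartesianProductWith _∷_ (allFin n) (allVecs n k) ⟩
  length (allFin n) * length (allVecs n k)
    ≡⟨ cong₂ _*_ (length-tabulate {n = n} (λ i → i)) (length-allVecs n k) ⟩
  n * n ^ k
    ∎
  where open ≡-Reasoning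

replicate-injective : ∀ {A : Set} {a b : A} k → 1 ≤ k → replicate k a ≡ replicate k b → a ≡ b
replicate-injective (suc _) _ = ∷-injectiveˡ

module _ {V : Set} {Adj : V → V → Set} where

  independenceNumber-≤-enumeration : ∀ {a xs} → IsIndependenceNumber Adj a →
    (∀ x → x ∈ xs) → a ≤ length xs
  independenceNumber-≤-enumeration ((S , (S! , _) , refl) , _) enum =
    Unique-length-≤ S! (λ {x} _ → enum x)

  independenceNumber-inhabited : ∀ {a} → IsIndependenceNumber Adj a → 0 < a → V
  independenceNumber-inhabited ((List.[] , _ , refl) , _) ()
  independenceNumber-inhabited ((x List.∷ _ , _) , _) _ = x

  independent-singleton : ∀ {x} → ¬ Adj x x → IsIndependent Adj [ x ]
  independent-singleton ¬xx = (All.[] ∷ []) , λ { (here refl) (here refl) → ¬xx }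

module _ {V₁ V₂ V : Set} {Adj₁ : V₁ → V₁ → Set} {Adj₂ : V₂ → V₂ → Set} {Adj : V → V → Set}
         (f : V₁ → V₂ → V) (f-injective : ∀ {w x y z} → f w y ≡ f x z → w ≡ x × y ≡ z)
         (f-¬Adj : ∀ x₁ y₁ x₂ y₂ → ¬ Adj₁ x₁ y₁ → ¬ Adj₂ x₂ y₂ → ¬ Adj (f x₁ x₂) (f y₁ y₂)) where

  independent-cartesianProductWith : ∀ {S T} → IsIndependent Adj₁ S → IsIndependent Adj₂ T →
    IsIndependent Adj (cartesianProductWith f S T)
  independent-cartesianProductWith {S} {T} (S! , S-indep) (T! , T-indep) =
    Unique.cartesianProductWith⁺ f f-injective S! T! , indep
    where
    indep : ∀ {x y} → x ∈ cartesianProductWith f S T → y ∈ cartesianProductWith f S T → ¬ Adj x y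
    indep x∈ y∈
      with _ , _ , x₁∈ , x₂∈ , refl ← ∈-cartesianProductWith⁻ f S T x∈
         | _ , _ , y₁∈ , y₂∈ , refl ← ∈-cartesianProductWith⁻ f S T y∈
      = f-¬Adj _ _ _ _ (S-indep x₁∈ y₁∈) (T-indep x₂∈ y₂∈)

module _ {n : ℕ} (G : Graph n) where

  edgeCount-++ : ∀ {a b} (x₁ y₁ : Vec (Fin n) a) (x₂ y₂ : Vec (Fin n) b) →
    edgeCount G (x₁ ++ x₂) (y₁ ++ y₂) ≡ edgeCount G x₁ y₁ + edgeCount G x₂ y₂
  edgeCount-++ []       []       x₂ y₂ = refl
  edgeCount-++ (u ∷ x₁) (v ∷ y₁) x₂ y₂ with adj G u v
  ... | true  = cong suc (edgeCount-++ x₁ y₁ x₂ y₂)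
  ... | false = edgeCount-++ x₁ y₁ x₂ y₂

  edgeCount-refl : ∀ {k} (x : Vec (Fin n) k) → edgeCount G x x ≡ 0
  edgeCount-refl []      = refl
  edgeCount-refl (u ∷ x) rewrite adj-irrefl G u = edgeCount-refl x

  edgeCount-replicate : ∀ k a b → k ∣ edgeCount G (replicate k a) (replicate k b)
  edgeCount-replicate k a b with adj G a b in ab
  ... | true  = subst (k ∣_) (sym (all-edges k)) ∣-refl
    where
    all-edges : ∀ k → edgeCount G (replicate k a) (replicate k b) ≡ k
    all-edges zero    = refl
    all-edges (suc k) rewrite ab = cong suc (all-edges k)
  ... | false = subst (k ∣_) (sym (no-edges k)) (k ∣0)
    where
    no-edges : ∀ k → edgeCount G (replicate k a) (replicate k b) ≡ 0
    no-edges zero    = refl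
    no-edges (suc k) rewrite ab = no-edges k

module _ {n : ℕ} (G : Graph n) (p : ℕ) where

  ¬PowAdj⇒∣ : ∀ {k} (x y : Vec (Fin n) k) → ¬ PowAdj G p k x y → p ∣ edgeCount G x y
  ¬PowAdj⇒∣ x y = decidable-stable (p ∣? edgeCount G x y)

  ¬PowAdj-refl : ∀ {k} (x : Vec (Fin n) k) → ¬ PowAdj G p k x x
  ¬PowAdj-refl x ∤0 = ∤0 (subst (p ∣_) (sym (edgeCount-refl G x)) (p ∣0))

  ¬PowAdj-++ : ∀ {a b} (x₁ y₁ : Vec (Fin n) a) (x₂ y₂ : Vec (Fin n) b) →
    ¬ PowAdj G p a x₁ y₁ → ¬ PowAdj G p b x₂ y₂ → ¬ PowAdj G p (a + b) (x₁ ++ x₂) (y₁ ++ y₂)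
  ¬PowAdj-++ x₁ y₁ x₂ y₂ ¬adj₁ ¬adj₂ ∤sum =
    ∤sum (subst (p ∣_) (sym (edgeCount-++ G x₁ y₁ x₂ y₂))
                 (∣m∣n⇒∣m+n (¬PowAdj⇒∣ x₁ y₁ ¬adj₁) (¬PowAdj⇒∣ x₂ y₂ ¬adj₂)))

  α-positive : ∀ {k a} → IsIndependenceNumber (PowAdj G p k) a → Fin n → 0 < a
  α-positive {k} (_ , maximal) v =
    maximal [ replicate k v ] (independent-singleton (¬PowAdj-refl (replicate k v)))

  α≤n^k : ∀ {k a} → IsIndependenceNumber (PowAdj G p k) a → a ≤ n ^ k
  α≤n^k {k} α-is =
    subst (_ ≤_) (length-allVecs n k) (independenceNumber-≤-enumeration α-is ∈-allVecs)

  α-superMultiplicative : ∀ {a b A B C} →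
    IsIndependenceNumber (PowAdj G p a) A → IsIndependenceNumber (PowAdj G p b) B →
    IsIndependenceNumber (PowAdj G p (a + b)) C → A * B ≤ C
  α-superMultiplicative ((S , S-indep , refl) , _) ((T , T-indep , refl) , _) (_ , maximal) =
    subst (_≤ _) (length-cartesianProductWith _++_ S T)
      (maximal _ (independent-cartesianProductWith _++_ (λ {w} {x} → ++-injective w x) ¬PowAdj-++
                                                   S-indep T-indep))

  n≤α[p] : ∀ {a} → 1 ≤ p → IsIndependenceNumber (PowAdj G p p) a → n ≤ a
  n≤α[p] {a} p≥1 (_ , maximal) =
    subst (_≤ a) length-diagonal (maximal diagonal (diagonal! , diagonal-indep))
    where
    diagonal = map (replicate p) (allFin n)
    length-diagonal : length diagonal ≡ n
    length-diagonal = trans (length-map (replicate p) (allFin n)) (length-tabulate {n = n} (λ i → i))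
    diagonal! : Unique diagonal
    diagonal! = Unique.map⁺ (replicate-injective p p≥1) (Unique.allFin⁺ n)
    diagonal-indep : ∀ {x y} → x ∈ diagonal → y ∈ diagonal → ¬ PowAdj G p p x y
    diagonal-indep x∈ y∈ ∤count
      with a , _ , refl ← ∈-map⁻ (replicate p) x∈
         | b , _ , refl ← ∈-map⁻ (replicate p) y∈
      = ∤count (edgeCount-replicate G p a b)

lemma2p1 : ∀ (n : ℕ) (G : Graph n) (p : ℕ) → 2 ≤ p →
    (α : ℕ → ℕ) → (∀ k → 1 ≤ k → IsIndependenceNumber (PowAdj G p k) (α k)) →
    -- lim_k α_k^{1/k} exists and equals sup_{k≥1} α_k^{1/k}:
    -- every rational u/v below some α_j^{1/j} is eventually below α_k^{1/k}
    (∀ (j u v : ℕ) → 1 ≤ j → 1 ≤ v → u ^ j < v ^ j * α j →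
      ∃ λ K → ∀ k → K ≤ k → 1 ≤ k → u ^ k < v ^ k * α k)
    -- n^{1/p} ≤ sup_{k≥1} α_k^{1/k}
    × (∀ (u v : ℕ) → 1 ≤ v → u ^ p < v ^ p * n →
      ∃ λ j → 1 ≤ j × u ^ j < v ^ j * α j)
    -- sup_{k≥1} α_k^{1/k} ≤ n
    × (∀ k → 1 ≤ k → α k ≤ n ^ k)
lemma2p1 n G p p≥2 α α-is = limit-is-sup , n≤sup , sup≤n
  where
  p≥1 : 1 ≤ p
  p≥1 = ≤-trans (n≤1+n 1) p≥2
  α-super : SuperMultiplicative α
  α-super a b a≥1 b≥1 =
    α-superMultiplicative G p (α-is a a≥1) (α-is b b≥1) (α-is (a + b) (≤-trans a≥1 (m≤m+n a b)))
  limit-is-sup : ∀ j u v → 1 ≤ j → 1 ≤ v → u ^ j < v ^ j * α j →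
    ∃ λ K → ∀ k → K ≤ k → 1 ≤ k → u ^ k < v ^ k * α k
  limit-is-sup j u v j≥1 v≥1 uʲ<vʲαⱼ =
    let K , above = eventually-above α-super α-pos j u v j≥1 v≥1 uʲ<vʲαⱼ
    in  K , λ k K≤k _ → above k K≤k
    where
    vertex : Fin n
    vertex = lookup (independenceNumber-inhabited (α-is j j≥1) (m<n*o⇒0<o (v ^ j) (α j) uʲ<vʲαⱼ))
                    (fromℕ< j≥1)
    α-pos : ∀ k → 1 ≤ k → 0 < α k
    α-pos k k≥1 = α-positive G p (α-is k k≥1) vertex
  n≤sup : ∀ u v → 1 ≤ v → u ^ p < v ^ p * n → ∃ λ j → 1 ≤ j × u ^ j < v ^ j * α j
  n≤sup u v _ uᵖ<vᵖn =
    p , p≥1 , <-≤-trans uᵖ<vᵖn (*-monoʳ-≤ (v ^ p) (n≤α[p] G p p≥1 (α-is p p≥1)))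
  sup≤n : ∀ k → 1 ≤ k → α k ≤ n ^ k
  sup≤n k k≥1 = α≤n^k G p (α-is k k≥1)
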